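{- Let $a\geq 1$, $t\geq \log_2(a)$, $s\geq t+4$ be integers, let $d\geq 2^s-2^t$ be an integer divisible by $2^t$, and let $b$ be an integer with $d-3\leq b\leq d$. Define \[ T_{t,s,d} := \{y\in\mathbb{N} : y\equiv 2^t,\ d+2^{t+1},\ d+2^{t+2},\ \ldots,\ d+2^{s-1} \pmod{2d}\}, \] \[ S_{a,b} := \{x\in\mathbb{N} : x\equiv \pm a \pmod{b+3}\}\setminus\{a,\ b+3-a\}. \] Then for all $n\geq 1$, \[ \rho(T_{t,s,d};2^t n)\geq \rho(S_{a,b};2^t n). \]
   Context: For a set $R$ of positive integers, $\rho(R;n)$ denotes the number of partitions of $n$ all of whose parts lie in $R$ (parts may repeat). -}

module Defs where

open import Data.Nat using (ℕ; zero; suc; _+_; _*_; _∸_; _^_; _≤_; _≤?_; _≟_)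
open import Data.Nat.DivMod using (_%_)
open import Data.Bool using (Bool; true; false; if_then_else_; _∨_; _∧_; not)
open import Data.List using (List; upTo)
open import Data.Bool.ListAction using (any)
open import Relation.Nullary.Decidable using (⌊_⌋)

-- residue of x modulo m (for m = 0 we return x, i.e. congruence mod 0 is equality)
mod : ℕ → ℕ → ℕ
mod x zero    = x
mod x (suc k) = x % suc k

congB : ℕ → ℕ → ℕ → Bool
congB x y m = ⌊ mod x m ≟ mod y m ⌋

sumTo : ℕ → (ℕ → ℕ) → ℕ
sumTo zero    f = f 0
sumTo (suc n) f = sumTo n f + f (suc n)

-- pk R k n = number of partitions of n all of whose parts lie in R ∩ {1,…,k}.
-- A partition is determined by the multiplicities of its parts; this is the
-- standard recursion on the largest allowed part k: choose the multiplicity j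
-- of the part k.
pk : (ℕ → Bool) → ℕ → ℕ → ℕ
pk R zero    n = if ⌊ n ≟ 0 ⌋ then 1 else 0
pk R (suc k) n =
  if R (suc k)
  then sumTo n (λ j → if ⌊ suc k * j ≤? n ⌋ then pk R k (n ∸ suc k * j) else 0)
  else pk R k n

ρ : (ℕ → Bool) → ℕ → ℕ
ρ R n = pk R n n

T : ℕ → ℕ → ℕ → ℕ → Bool
T t s d y =
  congB y (2 ^ t) (2 * d)
  ∨ any (λ j → congB y (d + 2 ^ (t + 1 + j)) (2 * d)) (upTo (s ∸ (t + 1)))

S : ℕ → ℕ → ℕ → Bool
S a b x =
  (congB x a (b + 3) ∨ congB (x + a) 0 (b + 3))
  ∧ not ⌊ x ≟ a ⌋
  ∧ not ⌊ x + a ≟ b + 3 ⌋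

module Submission where

-- A comparison principle: let w ∈ T divide every element of T, and suppose that
-- #(S ∩ [1, X]) ≤ #(T ∩ [1, X]) for every X. Then ρ(S; N) ≤ ρ(T; N) whenever w ∣ N.
-- By induction on the largest allowed part, the partitions of M into parts of S that
-- are at most k are no more than the partitions of M, rounded down to a multiple of w,
-- into parts of T that are at most k′, provided S has no more elements in [1, k] than
-- T has in [1, k′]: the largest part x of S is traded for the largest part y ≤ x of T,
-- and the room lost in doing so is filled up with copies of w.
--
-- With w = 2^t and m = b + 3 the counting hypothesis is checked by periodicity. Adding
-- the two excluded points a and m − a to S gives a set with two elements in every block
-- of length m, while T contains the four residues 2^t, d + 2^(t+1), d + 2^(t+2),
-- d + 2^(t+3) in every block of length 2d ≤ 2m. Splitting X = q m + r according to the
-- parity of q then gives #(S ∩ [1, X]) ≤ #(T ∩ [1, X]).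

open import Defs
open import Data.Bool using (Bool; true; false; if_then_else_; _∨_; _∧_; not)
open import Data.Bool.ListAction using (any)
open import Data.Bool.Properties using (∨-zeroʳ)
open import Data.Empty using (⊥-elim)
open import Data.List using (List; []; _∷_; length; upTo)
open import Data.List.Membership.Propositional using (_∈_)
open import Data.List.Membership.Propositional.Properties using (∈-upTo⁺)
open import Data.List.Relation.Unary.All using (All; []; _∷_)
open import Data.List.Relation.Unary.AllPairs as AllPairs using (AllPairs; []; _∷_)
open import Data.List.Relation.Unary.Any using (here; there)
open import Data.List.Relation.Unary.Linked using ([-]; _∷_)
open import Data.List.Relation.Unary.Linked.Properties using (Linked⇒AllPairs)
open import Data.Nat
open import Data.Nat.DivMod
open import Data.Nat.Divisibility
open import Data.Nat.Properties
open import Data.Nat.Tactic.RingSolver using (solve-∀)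
open import Data.Product using (∃; _,_)
open import Data.Sum using (_⊎_; inj₁; inj₂)
open import Function using (case_of_)
open import Relation.Binary.PropositionalEquality
open import Relation.Nullary using (Dec; ¬_)
open import Relation.Nullary.Decidable using (⌊_⌋; yes; no; dec-true; dec-false; isYes≗does)

true-or-false : ∀ b → b ≡ true ⊎ b ≡ false
true-or-false true  = inj₁ refl
true-or-false false = inj₂ refl

toℕ : Bool → ℕ
toℕ true  = 1
toℕ false = 0

toℕ-≤ : ∀ b {n} → (b ≡ true → 1 ≤ n) → toℕ b ≤ n
toℕ-≤ true  1≤n = 1≤n refl
toℕ-≤ false _   = z≤n

toℕ-≤1 : ∀ b → toℕ b ≤ 1
toℕ-≤1 b = toℕ-≤ b (λ _ → ≤-refl)

toℕ-∧-≤ : ∀ b c → toℕ (b ∧ c) ≤ toℕ b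
toℕ-∧-≤ true  c = toℕ-≤ c (λ _ → ≤-refl)
toℕ-∧-≤ false c = z≤n

⌊⌋-true : ∀ {P : Set} (p? : Dec P) → P → ⌊ p? ⌋ ≡ true
⌊⌋-true p? p = trans (isYes≗does p?) (dec-true p? p)

⌊⌋-false : ∀ {P : Set} (p? : Dec P) → ¬ P → ⌊ p? ⌋ ≡ false
⌊⌋-false p? ¬p = trans (isYes≗does p?) (dec-false p? ¬p)

⌊⌋-true⁻¹ : ∀ {P : Set} (p? : Dec P) → ⌊ p? ⌋ ≡ true → P
⌊⌋-true⁻¹ (yes p) _ = p

any-∈ : ∀ (f : ℕ → Bool) {x xs} → x ∈ xs → f x ≡ true → any f xs ≡ true
any-∈ f (here refl) fx rewrite fx = refl
any-∈ f {xs = y ∷ _} (there x∈xs) fx rewrite any-∈ f x∈xs fx = ∨-zeroʳ (f y)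

any-witness : ∀ (f : ℕ → Bool) xs → any f xs ≡ true → ∃ λ x → f x ≡ true
any-witness f (x ∷ xs) any≡true with f x in fx
... | true  = x , fx
... | false = any-witness f xs any≡true

sumTo-monoʳ-≤ : ∀ n {f g : ℕ → ℕ} → (∀ j → f j ≤ g j) → sumTo n f ≤ sumTo n g
sumTo-monoʳ-≤ zero    f≤g = f≤g 0
sumTo-monoʳ-≤ (suc n) f≤g = +-mono-≤ (sumTo-monoʳ-≤ n f≤g) (f≤g (suc n))

sumTo-monoˡ-≤ : ∀ (f : ℕ → ℕ) {m n} → m ≤ n → sumTo m f ≤ sumTo n f
sumTo-monoˡ-≤ f m≤n = go (≤⇒≤′ m≤n)
  where
  go : ∀ {m n} → m ≤′ n → sumTo m f ≤ sumTo n f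
  go ≤′-refl       = ≤-refl
  go (≤′-step m≤n) = ≤-trans (go m≤n) (m≤m+n _ _)

term≤sumTo : ∀ (f : ℕ → ℕ) {j n} → j ≤ n → f j ≤ sumTo n f
term≤sumTo f {j} j≤n = ≤-trans (last≤sumTo j) (sumTo-monoˡ-≤ f j≤n)
  where
  last≤sumTo : ∀ n → f n ≤ sumTo n f
  last≤sumTo zero    = ≤-refl
  last≤sumTo (suc n) = m≤n+m _ _

sumTo-suc : ∀ n (f : ℕ → ℕ) → sumTo (suc n) f ≡ f 0 + sumTo n (λ j → f (suc j))
sumTo-suc zero    f = refl
sumTo-suc (suc n) f = trans (cong (_+ f (suc (suc n))) (sumTo-suc n f)) (+-assoc (f 0) _ _)

sumTo-tail : ∀ (g : ℕ → ℕ) {m n} → m ≤ n → (∀ j → m < j → g j ≡ 0) → sumTo n g ≡ sumTo m g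
sumTo-tail g {m} m≤n vanish = go (≤⇒≤′ m≤n)
  where
  go : ∀ {n} → m ≤′ n → sumTo n g ≡ sumTo m g
  go ≤′-refl            = refl
  go (≤′-step {n} m≤n) =
    trans (cong₂ _+_ (go m≤n) (vanish (suc n) (s≤s (≤′⇒≤ m≤n)))) (+-identityʳ _)

sumTo-zero : ∀ n (u : ℕ → ℕ) → (∀ j → j ≤ n → u j ≡ 0) → sumTo n u ≡ 0
sumTo-zero zero    u u≡0 = u≡0 0 z≤n
sumTo-zero (suc n) u u≡0 =
  cong₂ _+_ (sumTo-zero n u (λ j j≤n → u≡0 j (m≤n⇒m≤1+n j≤n))) (u≡0 (suc n) ≤-refl)

sumTo-≤1 : ∀ n (u : ℕ → ℕ) → (∀ j → u j ≤ 1) → (∀ i j → 1 ≤ u i → 1 ≤ u j → i ≡ j) →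
           sumTo n u ≤ 1
sumTo-≤1 zero    u u≤1 unique = u≤1 0
sumTo-≤1 (suc n) u u≤1 unique with u (suc n) in eq
... | zero  = subst (_≤ 1) (sym (+-identityʳ _)) (sumTo-≤1 n u u≤1 unique)
... | suc x = subst (_≤ 1) (cong (_+ suc x) (sym earlier≡0)) (subst (_≤ 1) eq (u≤1 (suc n)))
  where
  earlier≡0 : sumTo n u ≡ 0
  earlier≡0 = sumTo-zero n u λ i i≤n → n≤0⇒n≡0 (≮⇒≥ λ 1≤uᵢ →
    <⇒≢ (s≤s i≤n) (unique i (suc n) 1≤uᵢ (subst (1 ≤_) (sym eq) (s≤s z≤n))))

atRemainder : (ℕ → ℕ) → ℕ → ℕ → ℕ
atRemainder f n x = if ⌊ x ≤? n ⌋ then f (n ∸ x) else 0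

atRemainder-mono : ∀ {f g : ℕ → ℕ} {n n′ x x′} → (x ≤ n → x′ ≤ n′) →
                   (x ≤ n → f (n ∸ x) ≤ g (n′ ∸ x′)) → atRemainder f n x ≤ atRemainder g n′ x′
atRemainder-mono {n = n} {n′} {x} {x′} fits f≤g with x ≤? n
... | no  _   = z≤n
... | yes x≤n with x′ ≤? n′
...   | yes _    = f≤g x≤n
...   | no  x′≰n′ = ⊥-elim (x′≰n′ (fits x≤n))

atRemainder-+ : ∀ f c n x → atRemainder f (c + n) (c + x) ≡ atRemainder f n x
atRemainder-+ f c n x with x ≤? n | c + x ≤? c + n
... | yes _   | yes _     = cong f ([m+n]∸[m+o]≡n∸o c n x)
... | yes x≤n | no  c+x≰c+n = ⊥-elim (c+x≰c+n (+-monoʳ-≤ c x≤n))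
... | no  x≰n | yes c+x≤c+n = ⊥-elim (x≰n (+-cancelˡ-≤ c x n c+x≤c+n))
... | no  _   | no  _     = refl

summand : (ℕ → Bool) → ℕ → ℕ → ℕ → ℕ
summand R k n j = atRemainder (pk R k) n (suc k * j)

pk-allowed : ∀ R k n → R (suc k) ≡ true → pk R (suc k) n ≡ sumTo n (summand R k n)
pk-allowed R k n R[1+k] rewrite R[1+k] = refl

pk-excluded : ∀ R k n → R (suc k) ≡ false → pk R (suc k) n ≡ pk R k n
pk-excluded R k n R[1+k] rewrite R[1+k] = refl

summand-0 : ∀ R k n → summand R k n 0 ≡ pk R k n
summand-0 R k n rewrite *-zeroʳ k = refl

summand-shift : ∀ R k n j → summand R k (n + suc k) (suc j) ≡ summand R k n j
summand-shift R k n j = begin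
  atRemainder (pk R k) (n + suc k) (suc k * suc j)
    ≡⟨ cong₂ (atRemainder (pk R k)) (+-comm n (suc k)) (*-suc (suc k) j) ⟩
  atRemainder (pk R k) (suc k + n) (suc k + suc k * j)
    ≡⟨ atRemainder-+ (pk R k) (suc k) n (suc k * j) ⟩
  atRemainder (pk R k) n (suc k * j) ∎
  where open ≡-Reasoning

pk-zero : ∀ R k → pk R k 0 ≡ 1
pk-zero R zero    = refl
pk-zero R (suc k) with true-or-false (R (suc k))
... | inj₁ allowed  = trans (pk-allowed R k 0 allowed) (trans (summand-0 R k 0) (pk-zero R k))
... | inj₂ excluded = trans (pk-excluded R k 0 excluded) (pk-zero R k)

pk-≤-suc : ∀ R k n → pk R k n ≤ pk R (suc k) n
pk-≤-suc R k n with true-or-false (R (suc k))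
... | inj₁ allowed  = begin
  pk R k n                ≡⟨ summand-0 R k n ⟨
  summand R k n 0         ≤⟨ term≤sumTo (summand R k n) {n = n} z≤n ⟩
  sumTo n (summand R k n) ≡⟨ pk-allowed R k n allowed ⟨
  pk R (suc k) n          ∎
  where open ≤-Reasoning
... | inj₂ excluded = ≤-reflexive (sym (pk-excluded R k n excluded))

pk-mono-+largest : ∀ R k → R (suc k) ≡ true → ∀ n → pk R (suc k) n ≤ pk R (suc k) (n + suc k)
pk-mono-+largest R k allowed n = begin
  pk R (suc k) n
    ≡⟨ pk-allowed R k n allowed ⟩
  sumTo n (summand R k n)
    ≤⟨ sumTo-monoʳ-≤ n (λ j → ≤-reflexive (sym (summand-shift R k n j))) ⟩
  sumTo n (λ j → f (suc j))
    ≤⟨ sumTo-monoˡ-≤ (λ j → f (suc j)) (m≤m+n n k) ⟩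
  sumTo (n + k) (λ j → f (suc j))
    ≤⟨ m≤n+m _ (f 0) ⟩
  f 0 + sumTo (n + k) (λ j → f (suc j))
    ≡⟨ sumTo-suc (n + k) f ⟨
  sumTo (suc (n + k)) f
    ≡⟨ cong (λ m → sumTo m f) (+-suc n k) ⟨
  sumTo (n + suc k) f
    ≡⟨ pk-allowed R k (n + suc k) allowed ⟨
  pk R (suc k) (n + suc k) ∎
  where
  open ≤-Reasoning
  f = summand R k (n + suc k)

pk-mono-+part : ∀ R {w} → R w ≡ true → ∀ k → w ≤ k → ∀ n → pk R k n ≤ pk R k (n + w)
pk-mono-+part R w∈R zero    z≤n n = ≤-reflexive (cong (pk R 0) (sym (+-identityʳ n)))
pk-mono-+part R {w} w∈R (suc k) w≤1+k n with m≤n⇒m<n∨m≡n w≤1+k | true-or-false (R (suc k))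
... | inj₂ refl    | _ = pk-mono-+largest R k w∈R n
... | inj₁ w<1+k   | inj₂ excluded = begin
  pk R (suc k) n       ≡⟨ pk-excluded R k n excluded ⟩
  pk R k n             ≤⟨ pk-mono-+part R w∈R k (≤-pred w<1+k) n ⟩
  pk R k (n + w)       ≡⟨ pk-excluded R k (n + w) excluded ⟨
  pk R (suc k) (n + w) ∎
  where open ≤-Reasoning
... | inj₁ w<1+k   | inj₁ allowed = begin
  pk R (suc k) n                      ≡⟨ pk-allowed R k n allowed ⟩
  sumTo n (summand R k n)             ≤⟨ sumTo-monoʳ-≤ n summand-≤ ⟩
  sumTo n (summand R k (n + w))       ≤⟨ sumTo-monoˡ-≤ (summand R k (n + w)) (m≤m+n n w) ⟩
  sumTo (n + w) (summand R k (n + w)) ≡⟨ pk-allowed R k (n + w) allowed ⟨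
  pk R (suc k) (n + w)                ∎
  where
  open ≤-Reasoning
  summand-≤ : ∀ j → summand R k n j ≤ summand R k (n + w) j
  summand-≤ j = atRemainder-mono {pk R k} {pk R k} {n} {n + w} {suc k * j}
    (λ x≤n → ≤-trans x≤n (m≤m+n n w)) λ x≤n →
    subst (pk R k (n ∸ suc k * j) ≤_) (cong (pk R k) (sym (+-∸-comm w x≤n)))
      (pk-mono-+part R w∈R k (≤-pred w<1+k) (n ∸ suc k * j))

pk-mono-+multiple : ∀ R {w} → R w ≡ true → ∀ k → w ≤ k → ∀ n q → pk R k n ≤ pk R k (n + q * w)
pk-mono-+multiple R w∈R k w≤k n zero = ≤-reflexive (cong (pk R k) (sym (+-identityʳ n)))
pk-mono-+multiple R {w} w∈R k w≤k n (suc q) = begin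
  pk R k n               ≤⟨ pk-mono-+part R w∈R k w≤k n ⟩
  pk R k (n + w)         ≤⟨ pk-mono-+multiple R w∈R k w≤k (n + w) q ⟩
  pk R k (n + w + q * w) ≡⟨ cong (pk R k) (+-assoc n w (q * w)) ⟩
  pk R k (n + (w + q * w)) ∎
  where open ≤-Reasoning

pk-mono-multiple : ∀ R {w} → R w ≡ true → ∀ k → w ≤ k → ∀ {m n} → m ≤ n → w ∣ n ∸ m →
                   pk R k m ≤ pk R k n
pk-mono-multiple R w∈R k w≤k {m} {n} m≤n (divides q n∸m≡q*w) =
  subst (λ l → pk R k m ≤ pk R k l) (trans (cong (m +_) (sym n∸m≡q*w)) (m+[n∸m]≡n m≤n))
    (pk-mono-+multiple R w∈R k w≤k m q)

1≤pk-multiple : ∀ R {w} → R w ≡ true → ∀ k → w ≤ k → ∀ q → 1 ≤ pk R k (q * w)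
1≤pk-multiple R {w} w∈R k w≤k q =
  subst (_≤ pk R k (q * w)) (pk-zero R k) (pk-mono-+multiple R w∈R k w≤k 0 q)

sumFrom1 : (ℕ → ℕ) → ℕ → ℕ
sumFrom1 f zero    = 0
sumFrom1 f (suc n) = sumFrom1 f n + f (suc n)

count : (ℕ → Bool) → ℕ → ℕ
count R = sumFrom1 (λ x → toℕ (R x))

count-allowed : ∀ R k → R (suc k) ≡ true → count R (suc k) ≡ suc (count R k)
count-allowed R k allowed rewrite allowed = +-comm (count R k) 1

count-excluded : ∀ R k → R (suc k) ≡ false → count R (suc k) ≡ count R k
count-excluded R k excluded rewrite excluded = +-identityʳ (count R k)

count-zero : ∀ R n → (∀ x → 1 ≤ x → x ≤ n → R x ≡ false) → count R n ≡ 0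
count-zero R zero    _    = refl
count-zero R (suc n) none = trans (count-excluded R n (none (suc n) (s≤s z≤n) ≤-refl))
  (count-zero R n (λ x 1≤x x≤n → none x 1≤x (m≤n⇒m≤1+n x≤n)))

count-monoʳ-≤ : ∀ R {m n} → m ≤ n → count R m ≤ count R n
count-monoʳ-≤ R m≤n = go (≤⇒≤′ m≤n)
  where
  go : ∀ {m n} → m ≤′ n → count R m ≤ count R n
  go ≤′-refl       = ≤-refl
  go (≤′-step m≤n) = ≤-trans (go m≤n) (m≤m+n _ _)

pk-no-parts : ∀ R k n → count R k ≡ 0 → pk R k n ≡ pk R 0 n
pk-no-parts R zero    n _    = refl
pk-no-parts R (suc k) n none with true-or-false (R (suc k))
... | inj₁ allowed  = ⊥-elim (1+n≢0 (trans (sym (count-allowed R k allowed)) none))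
... | inj₂ excluded = trans (pk-excluded R k n excluded)
  (pk-no-parts R k n (trans (sym (count-excluded R k excluded)) none))

pk₀-≤1 : ∀ R n → pk R 0 n ≤ 1
pk₀-≤1 R n with n ≟ 0
... | yes _ = ≤-refl
... | no  _ = z≤n

pk₀-positive : ∀ R n → 1 ≤ pk R 0 n → n ≡ 0
pk₀-positive R n 1≤ with n ≟ 0
... | yes n≡0 = n≡0
... | no  _   = ⊥-elim (n≮0 1≤)

pk-single-part-≤1 : ∀ R k n → count R k ≡ 0 → pk R (suc k) n ≤ 1
pk-single-part-≤1 R k n none with true-or-false (R (suc k))
... | inj₂ excluded =
  subst (_≤ 1) (sym (trans (pk-excluded R k n excluded) (pk-no-parts R k n none))) (pk₀-≤1 R n)
... | inj₁ allowed = subst (_≤ 1) (sym (pk-allowed R k n allowed))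
  (sumTo-≤1 n (summand R k n) summand-≤1
    λ i j hitᵢ hitⱼ → *-cancelˡ-≡ i j (suc k) (trans (hit i hitᵢ) (sym (hit j hitⱼ))))
  where
  summand-≤1 : ∀ j → summand R k n j ≤ 1
  summand-≤1 j with suc k * j ≤? n
  ... | no  _ = z≤n
  ... | yes _ = subst (_≤ 1) (sym (pk-no-parts R k _ none)) (pk₀-≤1 R _)
  hit : ∀ j → 1 ≤ summand R k n j → suc k * j ≡ n
  hit j 1≤ with suc k * j ≤? n
  ... | no  _   = ⊥-elim (n≮0 1≤)
  ... | yes x≤n = ≤-antisym x≤n (m∸n≡0⇒m≤n
    (pk₀-positive R _ (subst (1 ≤_) (pk-no-parts R k _ none) 1≤)))

∣m∣n⇒∣m∸n : ∀ {d m n} → d ∣ m → d ∣ n → d ∣ m ∸ n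
∣m∣n⇒∣m∸n {d} (divides p refl) (divides q refl) = divides (p ∸ q) (sym (*-distribʳ-∸ d p q))

module Comparison (S T : ℕ → Bool) (w : ℕ) .{{_ : NonZero w}} (w∈T : T w ≡ true)
                  (T⊆wℕ : ∀ {y} → T y ≡ true → w ∣ y)
                  (count-≤ : ∀ n → count S n ≤ count T n) where

  down : ℕ → ℕ
  down m = m / w * w

  down-≤ : ∀ m → down m ≤ m
  down-≤ m = m/n*n≤m m w

  down-∣ : ∀ m → w ∣ down m
  down-∣ m = divides (m / w) refl

  ≤-down : ∀ {l m} → w ∣ l → l ≤ m → l ≤ down m
  ≤-down {m = m} (divides q refl) l≤m =
    *-monoˡ-≤ w (subst (_≤ m / w) (m*n/n≡m q w) (/-monoˡ-≤ w l≤m))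

  summand-≤-down : ∀ {k k′} → k′ ≤ k → T (suc k′) ≡ true → w ≤ k′ →
                   (∀ m → pk S k m ≤ pk T k′ (down m)) →
                   ∀ m j → summand S k m j ≤ summand T k′ (down m) j
  summand-≤-down {k} {k′} k′≤k y∈T w≤k′ pk-≤ m j =
    atRemainder-mono {pk S k} {pk T k′} {m} {down m} {x} {y} fits value
    where
    x = suc k * j
    y = suc k′ * j
    w∣y : w ∣ y
    w∣y = ∣m⇒∣m*n j (T⊆wℕ y∈T)
    y≤x : y ≤ x
    y≤x = *-monoˡ-≤ j (s≤s k′≤k)
    fits : x ≤ m → y ≤ down m
    fits x≤m = ≤-down w∣y (≤-trans y≤x x≤m)
    value : x ≤ m → pk S k (m ∸ x) ≤ pk T k′ (down m ∸ y)
    value x≤m = ≤-trans (pk-≤ (m ∸ x))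
      (pk-mono-multiple T w∈T k′ w≤k′ lower (∣m∣n⇒∣m∸n (∣m∣n⇒∣m∸n (down-∣ m) w∣y) (down-∣ (m ∸ x))))
      where
      open ≤-Reasoning
      lower : down (m ∸ x) ≤ down m ∸ y
      lower = m+n≤o⇒m≤o∸n _ (≤-down (∣m∣n⇒∣m+n (down-∣ (m ∸ x)) w∣y) (begin
        down (m ∸ x) + y ≤⟨ +-mono-≤ (down-≤ (m ∸ x)) y≤x ⟩
        m ∸ x + x        ≡⟨ m∸n+n≡m x≤m ⟩
        m                ∎))

  sumTo-summand-≤-down : ∀ {k k′} → k′ ≤ k → T (suc k′) ≡ true → w ≤ k′ →
                         (∀ m → pk S k m ≤ pk T k′ (down m)) →
                         ∀ m → sumTo m (summand S k m) ≤ sumTo (down m) (summand T k′ (down m))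
  sumTo-summand-≤-down {k} {k′} k′≤k y∈T w≤k′ pk-≤ m =
    ≤-trans (sumTo-monoʳ-≤ m (summand-≤-down k′≤k y∈T w≤k′ pk-≤ m))
      (≤-reflexive (sumTo-tail (summand T k′ (down m)) (down-≤ m) beyond))
    where
    beyond : ∀ j → down m < j → summand T k′ (down m) j ≡ 0
    beyond j down<j with suc k′ * j ≤? down m
    ... | no  _ = refl
    ... | yes y≤down = ⊥-elim (<⇒≱ down<j (≤-trans (m≤n*m j (suc k′)) y≤down))

  pk-≤-pk-down : ∀ k k′ → k′ ≤ k → count S k ≤ count T k′ → ∀ m → pk S k m ≤ pk T k′ (down m)
  pk-≤-pk-down zero k′ _ _ m with m ≟ 0
  ... | yes refl = ≤-reflexive (sym (trans (cong (pk T k′) (n≤0⇒n≡0 (down-≤ 0))) (pk-zero T k′)))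
  ... | no  _    = z≤n
  pk-≤-pk-down (suc k) k′ k′≤1+k c m with true-or-false (S (suc k))
  pk-≤-pk-down (suc k) k′ k′≤1+k c m | inj₂ excluded with m≤n⇒m<n∨m≡n k′≤1+k
  ... | inj₁ k′<1+k = ≤-trans (≤-reflexive (pk-excluded S k m excluded))
    (pk-≤-pk-down k k′ (≤-pred k′<1+k) (subst (_≤ count T k′) (count-excluded S k excluded) c) m)
  ... | inj₂ refl   = ≤-trans (≤-reflexive (pk-excluded S k m excluded))
    (≤-trans (pk-≤-pk-down k k ≤-refl (count-≤ k) m) (pk-≤-suc T k (down m)))
  pk-≤-pk-down (suc k) zero _ c m | inj₁ allowed =
    ⊥-elim (n≮0 (subst (_≤ 0) (count-allowed S k allowed) c))
  pk-≤-pk-down (suc k) (suc k′) k′≤k c m | inj₁ allowed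
    with true-or-false (T (suc k′)) | w ≤? k′
  ... | inj₂ T-excluded | _ = ≤-trans
    (pk-≤-pk-down (suc k) k′ (m≤n⇒m≤1+n (≤-pred k′≤k))
      (subst (count S (suc k) ≤_) (count-excluded T k′ T-excluded) c) m)
    (≤-reflexive (sym (pk-excluded T k′ (down m) T-excluded)))
  ... | inj₁ T-allowed | yes w≤k′ = begin
    pk S (suc k) m                         ≡⟨ pk-allowed S k m allowed ⟩
    sumTo m (summand S k m)                ≤⟨ sumTo-summand-≤-down (≤-pred k′≤k) T-allowed w≤k′
                                                (pk-≤-pk-down k k′ (≤-pred k′≤k) c′) m ⟩
    sumTo (down m) (summand T k′ (down m)) ≡⟨ pk-allowed T k′ (down m) T-allowed ⟨
    pk T (suc k′) (down m)                 ∎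
    where
    open ≤-Reasoning
    c′ : count S k ≤ count T k′
    c′ = ≤-pred (subst₂ _≤_ (count-allowed S k allowed) (count-allowed T k′ T-allowed) c)
  ... | inj₁ T-allowed | no w≰k′ = begin
    pk S (suc k) m         ≤⟨ pk-single-part-≤1 S k m none-in-S ⟩
    1                      ≤⟨ 1≤pk-multiple T w∈T (suc k′) (∣⇒≤ (T⊆wℕ T-allowed)) (m / w) ⟩
    pk T (suc k′) (down m) ∎
    where
    open ≤-Reasoning
    below-w : ∀ x → 1 ≤ x → x ≤ k′ → T x ≡ false
    below-w (suc x) _ x≤k′ with true-or-false (T (suc x))
    ... | inj₁ x∈T = ⊥-elim (w≰k′ (≤-trans (∣⇒≤ (T⊆wℕ x∈T)) x≤k′))
    ... | inj₂ x∉T = x∉T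
    none-in-S : count S k ≡ 0
    none-in-S = n≤0⇒n≡0 (≤-pred (subst₂ _≤_ (count-allowed S k allowed)
      (trans (count-allowed T k′ T-allowed) (cong suc (count-zero T k′ below-w))) c))

  ρ-≤ : ∀ n → w ∣ n → ρ S n ≤ ρ T n
  ρ-≤ n w∣n = subst (ρ S n ≤_) (cong (pk T n) (m/n*n≡m w∣n))
    (pk-≤-pk-down n n ≤-refl (count-≤ n) n)

sumFrom1-mono-≤ : ∀ n {f g : ℕ → ℕ} → (∀ x → 1 ≤ x → x ≤ n → f x ≤ g x) →
                  sumFrom1 f n ≤ sumFrom1 g n
sumFrom1-mono-≤ zero    f≤g = z≤n
sumFrom1-mono-≤ (suc n) f≤g = +-mono-≤ (sumFrom1-mono-≤ n (λ x 1≤x x≤n → f≤g x 1≤x (m≤n⇒m≤1+n x≤n)))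
                                        (f≤g (suc n) (s≤s z≤n) ≤-refl)

sumFrom1-+ : ∀ (f g : ℕ → ℕ) n → sumFrom1 (λ x → f x + g x) n ≡ sumFrom1 f n + sumFrom1 g n
sumFrom1-+ f g zero    = refl
sumFrom1-+ f g (suc n) rewrite sumFrom1-+ f g n =
  interchange (sumFrom1 f n) (sumFrom1 g n) (f (suc n)) (g (suc n))
  where
  interchange : ∀ a b c d → a + b + (c + d) ≡ a + c + (b + d)
  interchange = solve-∀

sumFrom1-split : ∀ (f : ℕ → ℕ) m n →
                 sumFrom1 f (m + n) ≡ sumFrom1 f m + sumFrom1 (λ x → f (m + x)) n
sumFrom1-split f m zero    = trans (cong (sumFrom1 f) (+-identityʳ m)) (sym (+-identityʳ _))
sumFrom1-split f m (suc n) rewrite +-suc m n | sumFrom1-split f m n = +-assoc (sumFrom1 f m) _ _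

sumFrom1-periodic : ∀ (f : ℕ → ℕ) p → (∀ x → f (p + x) ≡ f x) →
                    ∀ q r → sumFrom1 f (q * p + r) ≡ q * sumFrom1 f p + sumFrom1 f r
sumFrom1-periodic f p periodic zero    r = refl
sumFrom1-periodic f p periodic (suc q) r = begin
  sumFrom1 f (p + q * p + r)                     ≡⟨ cong (sumFrom1 f) (+-assoc p (q * p) r) ⟩
  sumFrom1 f (p + (q * p + r))                   ≡⟨ sumFrom1-split f p (q * p + r) ⟩
  sumFrom1 f p + sumFrom1 (λ x → f (p + x)) (q * p + r)
    ≡⟨ cong (sumFrom1 f p +_) (sumFrom1-cong (q * p + r)) ⟩
  sumFrom1 f p + sumFrom1 f (q * p + r)
    ≡⟨ cong (sumFrom1 f p +_) (sumFrom1-periodic f p periodic q r) ⟩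
  sumFrom1 f p + (q * sumFrom1 f p + sumFrom1 f r) ≡⟨ +-assoc (sumFrom1 f p) _ _ ⟨
  sumFrom1 f p + q * sumFrom1 f p + sumFrom1 f r ∎
  where
  open ≡-Reasoning
  sumFrom1-cong : ∀ n → sumFrom1 (λ x → f (p + x)) n ≡ sumFrom1 f n
  sumFrom1-cong zero    = refl
  sumFrom1-cong (suc n) = cong₂ _+_ (sumFrom1-cong n) (periodic (suc n))

sumFrom1-point : ∀ {c} → 1 ≤ c → ∀ n → sumFrom1 (λ x → toℕ ⌊ x ≟ c ⌋) n ≡ toℕ ⌊ c ≤? n ⌋
sumFrom1-point {c} 1≤c zero = cong toℕ (sym (⌊⌋-false (c ≤? 0) (<⇒≱ 1≤c)))
sumFrom1-point {c} 1≤c (suc n) rewrite sumFrom1-point 1≤c n with suc n ≟ c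
... | yes refl = cong₂ (λ u v → toℕ u + toℕ v) (⌊⌋-false (suc n ≤? n) (<⇒≱ ≤-refl))
                                              (sym (⌊⌋-true (suc n ≤? suc n) ≤-refl))
... | no  1+n≢c with c ≤? n | c ≤? suc n
...   | yes _   | yes _     = refl
...   | no  _   | no  _     = refl
...   | yes c≤n | no  c≰1+n = ⊥-elim (c≰1+n (m≤n⇒m≤1+n c≤n))
...   | no  c≰n | yes c≤1+n = ⊥-elim (c≰n (≤-pred (≤∧≢⇒< c≤1+n (λ c≡1+n → 1+n≢c (sym c≡1+n)))))

hits : List ℕ → ℕ → ℕ
hits []       x = 0
hits (c ∷ cs) x = toℕ ⌊ x ≟ c ⌋ + hits cs x

reached : List ℕ → ℕ → ℕ
reached []       n = 0
reached (c ∷ cs) n = toℕ ⌊ c ≤? n ⌋ + reached cs n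

sumFrom1-hits : ∀ {cs} → All (1 ≤_) cs → ∀ n → sumFrom1 (hits cs) n ≡ reached cs n
sumFrom1-hits []             n = sumFrom1-zero n
  where
  sumFrom1-zero : ∀ n → sumFrom1 (λ _ → 0) n ≡ 0
  sumFrom1-zero zero    = refl
  sumFrom1-zero (suc n) = trans (+-identityʳ _) (sumFrom1-zero n)
sumFrom1-hits {c ∷ cs} (1≤c ∷ 1≤cs) n =
  trans (sumFrom1-+ (λ x → toℕ ⌊ x ≟ c ⌋) (hits cs) n)
        (cong₂ _+_ (sumFrom1-point 1≤c n) (sumFrom1-hits 1≤cs n))

hits-absent : ∀ {x cs} → All (x ≢_) cs → hits cs x ≡ 0
hits-absent []                    = refl
hits-absent {x} {c ∷ _} (x≢c ∷ x≢cs) rewrite ⌊⌋-false (x ≟ c) x≢c = hits-absent x≢cs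

hits-≤-member : ∀ (R : ℕ → Bool) {cs} → AllPairs _≢_ cs → All (λ c → R c ≡ true) cs →
                ∀ x → hits cs x ≤ toℕ (R x)
hits-≤-member R []                    []               x = z≤n
hits-≤-member R {c ∷ cs} (c≢cs ∷ distinct) (c∈R ∷ cs⊆R) x with x ≟ c
... | yes refl rewrite hits-absent c≢cs | c∈R = ≤-refl
... | no  _    = hits-≤-member R distinct cs⊆R x

reached-≤-length : ∀ cs n → reached cs n ≤ length cs
reached-≤-length []       n = z≤n
reached-≤-length (c ∷ cs) n with c ≤? n
... | yes _ = s≤s (reached-≤-length cs n)
... | no  _ = m≤n⇒m≤1+n (reached-≤-length cs n)

reached-all : ∀ {cs n} → All (_≤ n) cs → reached cs n ≡ length cs
reached-all []                         = refl
reached-all {c ∷ _} {n} (c≤n ∷ cs≤n) rewrite ⌊⌋-true (c ≤? n) c≤n = cong suc (reached-all cs≤n)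

reached-monoʳ-≤ : ∀ cs {m n} → m ≤ n → reached cs m ≤ reached cs n
reached-monoʳ-≤ []       m≤n = z≤n
reached-monoʳ-≤ (c ∷ cs) {m} {n} m≤n with c ≤? m | c ≤? n
... | yes _   | yes _   = s≤s (reached-monoʳ-≤ cs m≤n)
... | no  _   | yes _   = m≤n⇒m≤1+n (reached-monoʳ-≤ cs m≤n)
... | no  _   | no  _   = reached-monoʳ-≤ cs m≤n
... | yes c≤m | no  c≰n = ⊥-elim (c≰n (≤-trans c≤m m≤n))

reached-head : ∀ {c n} cs → c ≤ n → 1 ≤ reached (c ∷ cs) n
reached-head {c} {n} cs c≤n rewrite ⌊⌋-true (c ≤? n) c≤n = s≤s z≤n

hits-∈ : ∀ {x cs} → x ∈ cs → 1 ≤ hits cs x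
hits-∈ {x} (here refl) rewrite ⌊⌋-true (x ≟ x) refl = s≤s z≤n
hits-∈ (there x∈cs) = ≤-trans (hits-∈ x∈cs) (m≤n+m _ _)

count-periodic : ∀ R p → (∀ x → R (p + x) ≡ R x) →
                 ∀ q r → count R (q * p + r) ≡ q * count R p + count R r
count-periodic R p periodic = sumFrom1-periodic (λ x → toℕ (R x)) p (λ x → cong toℕ (periodic x))

reached-≤-count : ∀ R {cs} → All (1 ≤_) cs → AllPairs _≢_ cs → All (λ c → R c ≡ true) cs →
                  ∀ n → reached cs n ≤ count R n
reached-≤-count R positive distinct cs⊆R n = subst (_≤ count R n) (sumFrom1-hits positive n)
  (sumFrom1-mono-≤ n (λ x _ _ → hits-≤-member R distinct cs⊆R x))

count-≤-reached : ∀ R {cs} → All (1 ≤_) cs → ∀ p → (∀ x → 1 ≤ x → x ≤ p → toℕ (R x) ≤ hits cs x) →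
                  ∀ n → n ≤ p → count R n ≤ reached cs n
count-≤-reached R positive p R⊆cs n n≤p = subst (count R n ≤_) (sumFrom1-hits positive n)
  (sumFrom1-mono-≤ n (λ x 1≤x x≤n → R⊆cs x 1≤x (≤-trans x≤n n≤p)))

count-periodic-≥ : ∀ R p → (∀ x → R (p + x) ≡ R x) →
                   ∀ {cs} → All (1 ≤_) cs → AllPairs _≢_ cs → All (_≤ p) cs →
                   All (λ c → R c ≡ true) cs →
                   ∀ q r → q * length cs + reached cs r ≤ count R (q * p + r)
count-periodic-≥ R p periodic {cs} positive distinct cs≤p cs⊆R q r =
  subst (q * length cs + reached cs r ≤_) (sym (count-periodic R p periodic q r))
    (+-mono-≤ (*-monoʳ-≤ q (subst (_≤ count R p) (reached-all cs≤p)
                                   (reached-≤-count R positive distinct cs⊆R p)))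
              (reached-≤-count R positive distinct cs⊆R r))

count-periodic-≤ : ∀ R p → (∀ x → R (p + x) ≡ R x) →
                   ∀ {cs} → All (1 ≤_) cs → (∀ x → 1 ≤ x → x ≤ p → toℕ (R x) ≤ hits cs x) →
                   ∀ q r → r ≤ p → count R (q * p + r) ≤ q * length cs + reached cs r
count-periodic-≤ R p periodic {cs} positive R⊆cs q r r≤p =
  subst (_≤ q * length cs + reached cs r) (sym (count-periodic R p periodic q r))
    (+-mono-≤ (*-monoʳ-≤ q (≤-trans (count-≤-reached R positive p R⊆cs p ≤-refl)
                                     (reached-≤-length cs p)))
              (count-≤-reached R positive p R⊆cs r r≤p))

mod-+-self : ∀ m x → mod (m + x) m ≡ mod x m
mod-+-self zero    x = refl
mod-+-self (suc m) x = trans (cong (_% suc m) (+-comm (suc m) x)) ([m+n]%n≡m%n x (suc m))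

mod-self : ∀ m → mod m m ≡ mod 0 m
mod-self zero    = refl
mod-self (suc m) = n%n≡0 (suc m)

residue-injective : ∀ {m x y} → 1 ≤ x → x ≤ m → 1 ≤ y → y ≤ m → mod x m ≡ mod y m → x ≡ y
residue-injective {zero}  (s≤s _) () _ _ _
residue-injective {suc m} 1≤x x≤m 1≤y y≤m x≡y with m≤n⇒m<n∨m≡n x≤m | m≤n⇒m<n∨m≡n y≤m
... | inj₁ x<m  | inj₁ y<m  = trans (sym (m<n⇒m%n≡m x<m)) (trans x≡y (m<n⇒m%n≡m y<m))
... | inj₁ x<m  | inj₂ refl =
  ⊥-elim (<⇒≢ 1≤x (sym (trans (sym (m<n⇒m%n≡m x<m)) (trans x≡y (n%n≡0 (suc m))))))
... | inj₂ refl | inj₁ y<m  =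
  ⊥-elim (<⇒≢ 1≤y (sym (trans (sym (m<n⇒m%n≡m y<m)) (trans (sym x≡y) (n%n≡0 (suc m))))))
... | inj₂ refl | inj₂ refl = refl

∣-congB : ∀ {w} m {y c} → w ∣ m → w ∣ c → congB y c m ≡ true → w ∣ y
∣-congB {w} zero    {y} {c} _   w∣c y≡c = subst (w ∣_) (sym (⌊⌋-true⁻¹ (y ≟ c) y≡c)) w∣c
∣-congB {w} (suc m) {y} {c} w∣m w∣c y≡c =
  ∣n∣m%n⇒∣m w∣m (subst (w ∣_) (sym (⌊⌋-true⁻¹ (y % suc m ≟ c % suc m) y≡c)) (%-presˡ-∣ w∣c w∣m))

S± : ℕ → ℕ → ℕ → Bool
S± a m x = congB x a m ∨ congB (x + a) 0 m

S±-periodic : ∀ a m x → S± a m (m + x) ≡ S± a m x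
S±-periodic a m x rewrite +-assoc m x a | mod-+-self m x | mod-+-self m (x + a) = refl

+≡0-mod⇒≡m : ∀ {a m x} → a < m → 1 ≤ x → x ≤ m → mod (x + a) m ≡ mod 0 m → x + a ≡ m
+≡0-mod⇒≡m {a} {m} {x} a<m 1≤x x≤m x+a≡0 with x + a ≤? m
... | yes x+a≤m = residue-injective (≤-trans 1≤x (m≤m+n x a)) x+a≤m (≤-trans 1≤x x≤m) ≤-refl
                    (trans x+a≡0 (sym (mod-self m)))
... | no  x+a≰m = ⊥-elim (<⇒≢ excess<m
  (residue-injective (m<n⇒0<n∸m m<x+a) (<⇒≤ excess<m) (≤-trans 1≤x x≤m) ≤-refl (begin
    mod excess m        ≡⟨ mod-+-self m excess ⟨
    mod (m + excess) m  ≡⟨ cong (λ y → mod y m) (m+[n∸m]≡n (<⇒≤ m<x+a)) ⟩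
    mod (x + a) m       ≡⟨ x+a≡0 ⟩
    mod 0 m             ≡⟨ mod-self m ⟨
    mod m m             ∎)))
  where
  open ≡-Reasoning
  m<x+a : m < x + a
  m<x+a = ≰⇒> x+a≰m
  excess = x + a ∸ m
  excess<m : excess < m
  excess<m = subst (excess <_) (m+n∸n≡m m m) (∸-monoˡ-< (+-mono-≤-< x≤m a<m) (<⇒≤ m<x+a))

S±-members : ∀ {a m x} → 1 ≤ a → a < m → 1 ≤ x → x ≤ m → S± a m x ≡ true → x ≡ a ⊎ x ≡ m ∸ a
S±-members {a} {m} {x} 1≤a a<m 1≤x x≤m x∈S± with congB x a m in x≡a | congB (x + a) 0 m in x≡-a
... | true  | _    =
  inj₁ (residue-injective 1≤x x≤m 1≤a (<⇒≤ a<m) (⌊⌋-true⁻¹ (mod x m ≟ mod a m) x≡a))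
... | false | true = inj₂ (trans (sym (m+n∸n≡m x a)) (cong (_∸ a)
  (+≡0-mod⇒≡m a<m 1≤x x≤m (⌊⌋-true⁻¹ (mod (x + a) m ≟ mod 0 m) x≡-a))))

S±-boundary : ∀ {a m} → 1 ≤ a → a < m →
              ∀ x → 1 ≤ x → x ≤ m → toℕ (S± a m x) ≤ hits (a ∷ m ∸ a ∷ []) x
S±-boundary {a} {m} 1≤a a<m x 1≤x x≤m = toℕ-≤ (S± a m x) λ x∈S± → hits-∈ {cs = a ∷ m ∸ a ∷ []}
  (case S±-members 1≤a a<m 1≤x x≤m x∈S± of λ where
    (inj₁ x≡a)   → here x≡a
    (inj₂ x≡m∸a) → there (here x≡m∸a))

S+boundary≤S± : ∀ a b → a ≤ b + 3 → a ≢ b + 3 ∸ a →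
                ∀ x → toℕ (S a b x) + hits (a ∷ b + 3 ∸ a ∷ []) x ≤ toℕ (S± a (b + 3) x)
S+boundary≤S± a b a≤m a≢m∸a x = by-cases (x ≟ a) (x ≟ b + 3 ∸ a)
  where
  m = b + 3
  by-cases : Dec (x ≡ a) → Dec (x ≡ m ∸ a) →
             toℕ (S a b x) + hits (a ∷ m ∸ a ∷ []) x ≤ toℕ (S± a m x)
  by-cases (yes refl) _
    rewrite ⌊⌋-true (x ≟ x) refl | ⌊⌋-true (mod x m ≟ mod x m) refl
          | ⌊⌋-false (x ≟ m ∸ x) a≢m∸a = ≤-refl
  by-cases (no x≢a) (yes refl)
    rewrite ⌊⌋-false (m ∸ a ≟ a) x≢a | ⌊⌋-true (m ∸ a ≟ m ∸ a) refl
          | m∸n+n≡m a≤m | ⌊⌋-true (m ≟ m) refl | mod-self m | ⌊⌋-true (mod 0 m ≟ mod 0 m) refl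
          | ∨-zeroʳ (congB (m ∸ a) a m) = ≤-refl
  by-cases (no x≢a) (no x≢m∸a) = begin
    toℕ (S a b x) + hits (a ∷ m ∸ a ∷ []) x ≡⟨ cong (toℕ (S a b x) +_)
                                                    (hits-absent (x≢a ∷ x≢m∸a ∷ [])) ⟩
    toℕ (S a b x) + 0                       ≡⟨ +-identityʳ (toℕ (S a b x)) ⟩
    toℕ (S a b x)                           ≤⟨ toℕ-∧-≤ (S± a m x) _ ⟩
    toℕ (S± a m x)                          ∎
    where open ≤-Reasoning

count-S-bound : ∀ a b → 1 ≤ a → a + a < b + 3 → ∀ q r → r ≤ b + 3 →
                let B = a ∷ b + 3 ∸ a ∷ [] ; X = q * (b + 3) + r in
                count (S a b) X + reached B X ≤ q * 2 + reached B r
count-S-bound a b 1≤a 2a<m q r r≤m = begin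
  count (S a b) X + reached B X
    ≡⟨ cong (count (S a b) X +_) (sumFrom1-hits positive X) ⟨
  count (S a b) X + sumFrom1 (hits B) X
    ≡⟨ sumFrom1-+ (λ x → toℕ (S a b x)) (hits B) X ⟨
  sumFrom1 (λ x → toℕ (S a b x) + hits B x) X
    ≤⟨ sumFrom1-mono-≤ X (λ x _ _ → S+boundary≤S± a b (<⇒≤ a<m) a≢m∸a x) ⟩
  count (S± a m) X
    ≤⟨ count-periodic-≤ (S± a m) m (S±-periodic a m) positive (S±-boundary 1≤a a<m) q r r≤m ⟩
  q * 2 + reached B r ∎
  where
  open ≤-Reasoning
  m = b + 3
  B = a ∷ m ∸ a ∷ []
  X = q * m + r
  a<m : a < m
  a<m = ≤-trans (s≤s (m≤m+n a a)) 2a<m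
  a≢m∸a : a ≢ m ∸ a
  a≢m∸a a≡m∸a = <⇒≢ 2a<m (trans (cong (a +_) a≡m∸a) (m+[n∸m]≡n (<⇒≤ a<m)))
  positive : All (1 ≤_) B
  positive = 1≤a ∷ m<n⇒0<n∸m a<m ∷ []

T-periodic : ∀ t s d x → T t s d (2 * d + x) ≡ T t s d x
T-periodic t s d x rewrite mod-+-self (2 * d) x = refl

2^t∈T : ∀ t s d → T t s d (2 ^ t) ≡ true
2^t∈T t s d rewrite ⌊⌋-true (mod (2 ^ t) (2 * d) ≟ mod (2 ^ t) (2 * d)) refl = refl

shifted : ℕ → ℕ → ℕ → ℕ
shifted t d j = d + 2 ^ (t + 1 + j)

shifted∈T : ∀ t s d j → j < s ∸ (t + 1) → T t s d (shifted t d j) ≡ true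
shifted∈T t s d j j<s∸[t+1] = trans (cong (congB (shifted t d j) (2 ^ t) (2 * d) ∨_)
  (any-∈ (λ i → congB (shifted t d j) (shifted t d i) (2 * d)) (∈-upTo⁺ j<s∸[t+1])
    (⌊⌋-true (mod (shifted t d j) (2 * d) ≟ mod (shifted t d j) (2 * d)) refl)))
  (∨-zeroʳ _)

2^t∣2^[t+1+j] : ∀ t j → 2 ^ t ∣ 2 ^ (t + 1 + j)
2^t∣2^[t+1+j] t j = subst (2 ^ t ∣_)
  (sym (trans (cong (2 ^_) (+-assoc t 1 j)) (^-distribˡ-+-* 2 t (1 + j))))
  (m∣m*n (2 ^ (1 + j)))

T⊆2^tℕ : ∀ t s d → 2 ^ t ∣ d → ∀ {y} → T t s d y ≡ true → 2 ^ t ∣ y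
T⊆2^tℕ t s d w∣d {y} y∈T with congB y (2 ^ t) (2 * d) in y≡w
... | true  = ∣-congB (2 * d) (∣n⇒∣m*n 2 w∣d) ∣-refl y≡w
... | false with any-witness _ (upTo (s ∸ (t + 1))) y∈T
...   | j , y≡shifted =
  ∣-congB (2 * d) (∣n⇒∣m*n 2 w∣d) (∣m∣n⇒∣m+n w∣d (2^t∣2^[t+1+j] t j)) y≡shifted

T-points : ℕ → ℕ → List ℕ
T-points t d = 2 ^ t ∷ shifted t d 0 ∷ shifted t d 1 ∷ shifted t d 2 ∷ []

T-points-≤ : ∀ t d {n} → d + 2 ^ t * 8 ≤ n → All (_≤ n) (T-points t d)
T-points-≤ t d {n} d+8w≤n =
  ≤-trans (m≤m*n (2 ^ t) 8) (≤-trans (m≤n+m _ d) d+8w≤n) ∷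
  shifted≤ 0 z≤n ∷ shifted≤ 1 (s≤s z≤n) ∷ shifted≤ 2 ≤-refl ∷ []
  where
  shifted≤ : ∀ j → j ≤ 2 → shifted t d j ≤ n
  shifted≤ j j≤2 = ≤-trans (+-monoʳ-≤ d (begin
    2 ^ (t + 1 + j) ≤⟨ ^-monoʳ-≤ 2 (subst (_≤ t + 3) (sym (+-assoc t 1 j))
                                        (+-monoʳ-≤ t (s≤s j≤2))) ⟩
    2 ^ (t + 3)     ≡⟨ ^-distribˡ-+-* 2 t 3 ⟩
    2 ^ t * 8       ∎)) d+8w≤n
    where open ≤-Reasoning

count-T-bound : ∀ t s d → t + 4 ≤ s → 2 ^ t * 8 ≤ d →
                ∀ q r → q * 4 + reached (T-points t d) r ≤ count (T t s d) (q * (2 * d) + r)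
count-T-bound t s d t+4≤s 8w≤d =
  count-periodic-≥ (T t s d) (2 * d) (T-periodic t s d) positive distinct
    (T-points-≤ t d (subst (d + 2 ^ t * 8 ≤_) (cong (d +_) (sym (+-identityʳ d)))
                                              (+-monoʳ-≤ d 8w≤d)))
    (2^t∈T t s d ∷ member 0 z≤n ∷ member 1 (s≤s z≤n) ∷ member 2 ≤-refl ∷ [])
  where
  w<shifted : ∀ j → 2 ^ t < shifted t d j
  w<shifted j = subst (_< shifted t d j) (+-identityʳ (2 ^ t))
    (+-mono-≤-< (≤-trans (m≤m*n (2 ^ t) 8) 8w≤d) (m^n>0 2 (t + 1 + j)))
  shifted-< : ∀ j → shifted t d j < shifted t d (suc j)
  shifted-< j = +-monoʳ-< d (^-monoʳ-< 2 (s≤s (s≤s z≤n)) (+-monoʳ-< (t + 1) (n<1+n j)))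
  positive : All (1 ≤_) (T-points t d)
  positive = m^n>0 2 t ∷ pos 0 ∷ pos 1 ∷ pos 2 ∷ []
    where pos = λ j → ≤-trans (s≤s z≤n) (w<shifted j)
  distinct : AllPairs _≢_ (T-points t d)
  distinct = AllPairs.map <⇒≢
    (Linked⇒AllPairs <-trans (w<shifted 0 ∷ shifted-< 0 ∷ shifted-< 1 ∷ [-]))
  member : ∀ j → j ≤ 2 → T t s d (shifted t d j) ≡ true
  member j j≤2 = shifted∈T t s d j (≤-trans (s≤s j≤2)
    (m+n≤o⇒m≤o∸n 3 (subst (_≤ s) (trans (+-comm t 4) (cong (3 +_) (+-comm 1 t))) t+4≤s)))

boundary≤T-points : ∀ {a m r} t d → 2 ^ t ≤ d → a + 2 ^ t * 8 ≤ m →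
                    reached (a ∷ m ∸ a ∷ []) r ≤ reached (T-points t d) (d + r)
boundary≤T-points {a} {m} {r} t d w≤d a+8w≤m = by-cases (m ∸ a ≤? r)
  where
  open ≤-Reasoning
  w≤d+r : 2 ^ t ≤ d + r
  w≤d+r = ≤-trans w≤d (m≤m+n d r)
  by-cases : Dec (m ∸ a ≤ r) → reached (a ∷ m ∸ a ∷ []) r ≤ reached (T-points t d) (d + r)
  by-cases (yes m∸a≤r) = begin
    reached (a ∷ m ∸ a ∷ []) r     ≤⟨ reached-≤-length (a ∷ m ∸ a ∷ []) r ⟩
    2                              ≤⟨ m≤m+n 2 2 ⟩
    4                              ≡⟨ reached-all (T-points-≤ t d (+-monoʳ-≤ d 8w≤r)) ⟨
    reached (T-points t d) (d + r) ∎
    where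
    8w≤r : 2 ^ t * 8 ≤ r
    8w≤r = ≤-trans (m+n≤o⇒m≤o∸n (2 ^ t * 8) (subst (_≤ m) (+-comm a _) a+8w≤m)) m∸a≤r
  by-cases (no m∸a≰r) = begin
    reached (a ∷ m ∸ a ∷ []) r     ≡⟨ cong (λ b → toℕ ⌊ a ≤? r ⌋ + (toℕ b + 0))
                                            (⌊⌋-false (m ∸ a ≤? r) m∸a≰r) ⟩
    toℕ ⌊ a ≤? r ⌋ + 0             ≡⟨ +-identityʳ _ ⟩
    toℕ ⌊ a ≤? r ⌋                 ≤⟨ toℕ-≤1 _ ⟩
    1                              ≤⟨ reached-head (shifted t d 0 ∷ shifted t d 1 ∷ shifted t d 2 ∷ [])
                                                   w≤d+r ⟩
    reached (T-points t d) (d + r) ∎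

even-or-odd : ∀ q → q ≡ q / 2 * 2 ⊎ q ≡ 1 + q / 2 * 2
even-or-odd q with q % 2 | m≡m%n+[m/n]*n q 2 | m%n<n q 2
... | 0           | q≡ | _ = inj₁ q≡
... | 1           | q≡ | _ = inj₂ q≡
... | suc (suc _) | _  | s≤s (s≤s ())

count-S≤count-T : ∀ a t s d b → 1 ≤ a → a ≤ 2 ^ t → t + 4 ≤ s → 2 ^ t * 15 ≤ d → d ≤ b + 3 →
                  ∀ n → count (S a b) n ≤ count (T t s d) n
count-S≤count-T a t s d b 1≤a a≤w t+4≤s 15w≤d d≤m n =
  subst S≼T (sym n≡qm+r) (by-parity (even-or-odd q))
  where
  S≼T : ℕ → Set
  S≼T X = count (S a b) X ≤ count (T t s d) X
  m = b + 3
  instance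
    m≢0 : NonZero m
    m≢0 = >-nonZero (≤-trans (s≤s z≤n) (m≤n+m 3 b))
  w = 2 ^ t
  q = n / m
  r = n % m
  B = a ∷ m ∸ a ∷ []
  n≡qm+r : n ≡ q * m + r
  n≡qm+r = trans (m≡m%n+[m/n]*n n m) (+-comm r (q * m))
  r≤m : r ≤ m
  r≤m = m%n≤n n m
  8w≤d : w * 8 ≤ d
  8w≤d = ≤-trans (*-monoʳ-≤ w (m≤m+n 8 7)) 15w≤d
  w≤d : w ≤ d
  w≤d = ≤-trans (m≤m*n w 8) 8w≤d
  w*15≤m : w * 15 ≤ m
  w*15≤m = ≤-trans 15w≤d d≤m
  2a<m : a + a < m
  2a<m = begin-strict
    a + a     ≤⟨ +-mono-≤ a≤w a≤w ⟩
    w + w     <⟨ m<m+n (w + w) (m^n>0 2 t) ⟩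
    w + w + w ≡⟨ w+w+w≡w*3 w ⟩
    w * 3     ≤⟨ *-monoʳ-≤ w (m≤m+n 3 12) ⟩
    w * 15    ≤⟨ w*15≤m ⟩
    m         ∎
    where
    open ≤-Reasoning
    w+w+w≡w*3 : ∀ w → w + w + w ≡ w * 3
    w+w+w≡w*3 = solve-∀
  a+8w≤m : a + w * 8 ≤ m
  a+8w≤m = begin
    a + w * 8 ≤⟨ +-monoˡ-≤ (w * 8) a≤w ⟩
    w + w * 8 ≡⟨ w+w*8≡w*9 w ⟩
    w * 9     ≤⟨ *-monoʳ-≤ w (m≤m+n 9 6) ⟩
    w * 15    ≤⟨ w*15≤m ⟩
    m         ∎
    where
    open ≤-Reasoning
    w+w*8≡w*9 : ∀ w → w + w * 8 ≡ w * 9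
    w+w*8≡w*9 = solve-∀

  even-case : ∀ Q → S≼T (Q * 2 * m + r)
  even-case Q = begin
    count (S a b) X                  ≤⟨ +-cancelʳ-≤ (reached B X) _ _ (begin
      count (S a b) X + reached B X    ≤⟨ count-S-bound a b 1≤a 2a<m (Q * 2) r r≤m ⟩
      Q * 2 * 2 + reached B r          ≤⟨ +-monoʳ-≤ (Q * 2 * 2)
                                            (reached-monoʳ-≤ B (m≤n+m r (Q * 2 * m))) ⟩
      Q * 2 * 2 + reached B X          ∎) ⟩
    Q * 2 * 2                        ≡⟨ *-assoc Q 2 2 ⟩
    Q * 4                            ≤⟨ m≤m+n (Q * 4) _ ⟩
    Q * 4 + reached (T-points t d) 0 ≤⟨ count-T-bound t s d t+4≤s 8w≤d Q 0 ⟩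
    count (T t s d) (Q * (2 * d) + 0) ≤⟨ count-monoʳ-≤ (T t s d) (+-mono-≤ Q*2d≤Q*2*m z≤n) ⟩
    count (T t s d) X                ∎
    where
    open ≤-Reasoning
    X = Q * 2 * m + r
    Q*2d≤Q*2*m : Q * (2 * d) ≤ Q * 2 * m
    Q*2d≤Q*2*m = subst (_≤ Q * 2 * m) (*-assoc Q 2 d) (*-monoʳ-≤ (Q * 2) d≤m)

  odd-case : ∀ Q → S≼T ((1 + Q * 2) * m + r)
  odd-case Q = begin
    count (S a b) X                        ≤⟨ +-cancelˡ-≤ 2 _ _ (begin
      2 + count (S a b) X                    ≡⟨ +-comm 2 _ ⟩
      count (S a b) X + 2                    ≡⟨ cong (count (S a b) X +_)
                                                  (reached-all (a≤X ∷ m∸a≤X ∷ [])) ⟨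
      count (S a b) X + reached B X          ≤⟨ count-S-bound a b 1≤a 2a<m (1 + Q * 2) r r≤m ⟩
      2 + Q * 2 * 2 + reached B r            ≡⟨ +-assoc 2 (Q * 2 * 2) _ ⟩
      2 + (Q * 2 * 2 + reached B r)          ∎) ⟩
    Q * 2 * 2 + reached B r                ≤⟨ +-mono-≤ (≤-reflexive (*-assoc Q 2 2))
                                                        (boundary≤T-points t d w≤d a+8w≤m) ⟩
    Q * 4 + reached (T-points t d) (d + r) ≤⟨ count-T-bound t s d t+4≤s 8w≤d Q (d + r) ⟩
    count (T t s d) (Q * (2 * d) + (d + r)) ≤⟨ count-monoʳ-≤ (T t s d) fits ⟩
    count (T t s d) X                      ∎
    where
    open ≤-Reasoning
    X = (1 + Q * 2) * m + r
    m≤X : m ≤ X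
    m≤X = ≤-trans (m≤m+n m (Q * 2 * m)) (m≤m+n _ r)
    a≤X : a ≤ X
    a≤X = ≤-trans (<⇒≤ (≤-trans (s≤s (m≤m+n a a)) 2a<m)) m≤X
    m∸a≤X : m ∸ a ≤ X
    m∸a≤X = ≤-trans (m∸n≤m m a) m≤X
    rearrange : ∀ Q d r → Q * (2 * d) + (d + r) ≡ d + Q * 2 * d + r
    rearrange = solve-∀
    fits : Q * (2 * d) + (d + r) ≤ X
    fits = subst (_≤ X) (sym (rearrange Q d r)) (+-monoˡ-≤ r (+-mono-≤ d≤m (*-monoʳ-≤ (Q * 2) d≤m)))

  by-parity : q ≡ q / 2 * 2 ⊎ q ≡ 1 + q / 2 * 2 → S≼T (q * m + r)
  by-parity (inj₁ even) = subst (λ q → S≼T (q * m + r)) (sym even) (even-case (q / 2))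
  by-parity (inj₂ odd)  = subst (λ q → S≼T (q * m + r)) (sym odd) (odd-case (q / 2))

2^t*15≤d : ∀ t s d → t + 4 ≤ s → 2 ^ s ∸ 2 ^ t ≤ d → 2 ^ t * 15 ≤ d
2^t*15≤d t s d t+4≤s d≥2^s∸2^t = begin
  2 ^ t * 15             ≡⟨ *-distribˡ-∸ (2 ^ t) 16 1 ⟩
  2 ^ t * 16 ∸ 2 ^ t * 1 ≡⟨ cong (2 ^ t * 16 ∸_) (*-identityʳ (2 ^ t)) ⟩
  2 ^ t * 16 ∸ 2 ^ t     ≡⟨ cong (_∸ 2 ^ t) (^-distribˡ-+-* 2 t 4) ⟨
  2 ^ (t + 4) ∸ 2 ^ t    ≤⟨ ∸-monoˡ-≤ (2 ^ t) (^-monoʳ-≤ 2 t+4≤s) ⟩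
  2 ^ s ∸ 2 ^ t          ≤⟨ d≥2^s∸2^t ⟩
  d                      ∎
  where open ≤-Reasoning

corollary2p3 : (a t s d b : ℕ) → 1 ≤ a → a ≤ 2 ^ t → s ≥ t + 4
    → d ≥ 2 ^ s ∸ 2 ^ t → 2 ^ t ∣ d → d ≤ b + 3 → b ≤ d
    → (n : ℕ) → 1 ≤ n → ρ (T t s d) (2 ^ t * n) ≥ ρ (S a b) (2 ^ t * n)
corollary2p3 a t s d b 1≤a a≤2^t t+4≤s d≥2^s∸2^t 2^t∣d d≤b+3 _ n _ =
  Comparison.ρ-≤ (S a b) (T t s d) (2 ^ t) {{m^n≢0 2 t}} (2^t∈T t s d) (T⊆2^tℕ t s d 2^t∣d)
    (count-S≤count-T a t s d b 1≤a a≤2^t t+4≤s (2^t*15≤d t s d t+4≤s d≥2^s∸2^t) d≤b+3)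
    (2 ^ t * n) (m∣m*n n)
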